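{- Let $n\ge 2$ and order $\mathcal{S}_n=(p_0,p_1,\ldots,p_{n!-1})$ by generation by cyclic shift. For $p\in\mathcal{S}_n$, let $p^{(1)}=(x_1),p^{(2)},\ldots,p^{(n)}=p$ be the unique sequence with $p^{(m)}\in\mathcal{S}_m$ and $p^{(m)}=S_m^{c_m}p^{(m-1)}$ for some $c_m\in\{0,\ldots,m-1\}$ ($m=2,\ldots,n$), and define the code of $p$ as $\alpha=\sum_{i=0}^{n-2}\alpha_i\varpi_{n,i}$ with $\alpha_i=c_{n-i}$. Then the rank of $p$ (its index in the ordering, an element of $\mathbb{Z}_{n!}$) equals its code. Conversely, for $\alpha\in\mathbb{Z}_{n!}$ with $\varpi$-system digits $\alpha_{n-2},\ldots,\alpha_0$, the permutation $p_\alpha$ is obtained from $(x_1)$ by successively applying $S_2^{\alpha_{n-2}},S_3^{\alpha_{n-3}},\ldots,S_n^{\alpha_0}$.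
   Context: Let $x_1,x_2,\ldots$ be distinct symbols; $\mathcal{S}_m$ is the set of words in which each of $x_1,\ldots,x_m$ occurs exactly once. For $q=(a_1\cdots a_{m-1})\in\mathcal{S}_{m-1}$ and $j\in\{0,\ldots,m-1\}$, the cyclic shift is $S_m^jq=C^j(a_1\cdots a_{m-1}x_m)\in\mathcal{S}_m$, where $C(c_1c_2\cdots c_m)=(c_2\cdots c_mc_1)$. Ordering by generation by cyclic shift: $\mathcal{S}_1=((x_1))$; if $\mathcal{S}_{m-1}$ is ordered as $(q_0,\ldots,q_{(m-1)!-1})$, then $\mathcal{S}_m$ is ordered as $(p_0,\ldots,p_{m!-1})$ with $p_{m\beta+j}=S_m^jq_\beta$ for $\beta\in\{0,\ldots,(m-1)!-1\}$, $j\in\{0,\ldots,m-1\}$. The $\varpi$-system: $\varpi_{n,0}=1$, $\varpi_{n,i}=n(n-1)\cdots(n-i+1)$ for $1\le i\le n-2$; each $\alpha\in\mathbb{Z}_{n!}$ (identified with $\{0,\ldots,n!-1\}$) is uniquely $\alpha=\sum_{i=0}^{n-2}\alpha_i\varpi_{n,i}$ with digits $\alpha_i\in\{0,\ldots,n-i-1\}$. -}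

module Defs where

open import Data.Nat using (ℕ; zero; suc; _+_; _*_; _∸_)
open import Data.List using (List; []; _∷_; _++_; [_]; map; concatMap; upTo)
open import Data.Nat.ListAction using (sum)
open import Data.Maybe using (Maybe; just; nothing)

-- A word is a list of symbol indices; the symbol x_i is represented by i (1-based).
Word : Set
Word = List ℕ

C : Word → Word
C []       = []
C (c ∷ cs) = cs ++ [ c ]

C^ : ℕ → Word → Word
C^ zero    w = w
C^ (suc j) w = C (C^ j w)

S : (m j : ℕ) → Word → Word
S m j q = C^ j (q ++ [ m ])

-- The ordered list (p_0, ..., p_{m!-1}) of S_m, ordered by generation by cyclic shift:
-- S_1 = ((x_1)); p_{mβ+j} = S_m^j q_β  (for each q_β in order, j = 0..m-1).
ordering : ℕ → List Word
ordering zero          = []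
ordering (suc zero)    = [ 1 ∷ [] ]
ordering (suc (suc k)) =
  concatMap (λ q → map (λ j → S (suc (suc k)) j q) (upTo (suc (suc k)))) (ordering (suc k))

_‼_ : {A : Set} → List A → ℕ → Maybe A
[]       ‼ _       = nothing
(x ∷ xs) ‼ zero    = just x
(x ∷ xs) ‼ (suc i) = xs ‼ i

ϖ : ℕ → ℕ → ℕ
ϖ n zero    = 1
ϖ n (suc i) = (n ∸ i) * ϖ n i

build : ℕ → (ℕ → ℕ) → Word
build zero          c = []
build (suc zero)    c = 1 ∷ []
build (suc (suc k)) c = S (suc (suc k)) (c (suc (suc k))) (build (suc k) c)

code : ℕ → (ℕ → ℕ) → ℕ
code n c = sum (map (λ i → c (n ∸ i) * ϖ n i) (upTo (n ∸ 1)))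

digitsValue : ℕ → (ℕ → ℕ) → ℕ
digitsValue n d = sum (map (λ i → d i * ϖ n i) (upTo (n ∸ 1)))

-- The words S_m^0 q, …, S_m^{m-1} q form the block of q in the ordering of S_m, so the
-- index of S_m^j q is m · (index of q) + j.  Unfolding this along p^{(1)}, …, p^{(n)} is
-- Horner's scheme for the ϖ-expansion, because ϖ_{m,i+1} = m · ϖ_{m-1,i}.  Every
-- permutation is reached: writing p = u x_n v, the word v u is a permutation of
-- x_1 … x_{n-1}, and p = S_n^{|v|} (v u).
module Submission where

open import Defs
open import Data.Nat using (ℕ; zero; suc; _+_; _*_; _∸_; _≤_; _<_; _≟_; _!; s≤s; z≤n)
open import Data.Nat.Properties
open import Data.Nat.ListAction using (sum)
open import Data.List using (List; []; _∷_; _++_; [_]; _∷ʳ_; map; concatMap; applyUpTo; upTo; length)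
open import Data.List.Properties
  using (length-++; length-map; length-upTo; map-upTo; map-applyUpTo; upTo-∷ʳ; map-++; ++-assoc; ++-identityʳ)
open import Data.List.Membership.Propositional.Properties using (∈-∃++; ∈-++⁺ʳ)
open import Data.List.Relation.Unary.Any using (here)
open import Data.List.Relation.Binary.Permutation.Propositional using (_↭_; ↭-sym; ↭-trans)
open import Data.List.Relation.Binary.Permutation.Propositional.Properties
  using (↭-singleton-inv; ↭-length; drop-mid; ∈-resp-↭; ++-comm)
open import Data.Maybe using (just)
open import Data.Product using (Σ; ∃₂; _×_; _,_; proj₁; proj₂)
open import Data.Empty using (⊥-elim)
open import Relation.Nullary using (¬_; yes; no)
open import Relation.Binary.PropositionalEquality
  using (_≡_; refl; sym; trans; cong; cong₂; subst; module ≡-Reasoning)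
open import Algebra.Properties.CommutativeSemigroup +-commutativeSemigroup
  using () renaming (x∙yz≈y∙xz to +-left-comm)
open import Algebra.Properties.CommutativeSemigroup *-commutativeSemigroup
  using () renaming (x∙yz≈y∙xz to *-left-comm)

‼-++ˡ : {A : Set} (xs ys : List A) (i : ℕ) {x : A} → xs ‼ i ≡ just x → (xs ++ ys) ‼ i ≡ just x
‼-++ˡ (x ∷ xs) ys zero    eq = eq
‼-++ˡ (x ∷ xs) ys (suc i) eq = ‼-++ˡ xs ys i eq

‼-++ʳ : {A : Set} (xs ys : List A) (i : ℕ) → (xs ++ ys) ‼ (length xs + i) ≡ ys ‼ i
‼-++ʳ []       ys i = refl
‼-++ʳ (x ∷ xs) ys i = ‼-++ʳ xs ys i

‼-applyUpTo : {A : Set} (f : ℕ → A) {m j : ℕ} → j < m → applyUpTo f m ‼ j ≡ just (f j)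
‼-applyUpTo f {suc m} {zero}  _       = refl
‼-applyUpTo f {suc m} {suc j} (s≤s j<m) = ‼-applyUpTo (λ i → f (suc i)) j<m

‼-concatMap : {A B : Set} (f : A → List B) (m : ℕ) → (∀ x → length (f x) ≡ m) →
  (xs : List A) (r j : ℕ) {x : A} {y : B} → xs ‼ r ≡ just x → f x ‼ j ≡ just y →
  concatMap f xs ‼ (j + m * r) ≡ just y
‼-concatMap f m len (x ∷ xs) zero j refl fx‼j rewrite *-zeroʳ m | +-identityʳ j =
  ‼-++ˡ (f x) _ j fx‼j
‼-concatMap f m len (x ∷ xs) (suc r) j xs‼r fx‼j = begin
  concatMap f (x ∷ xs) ‼ (j + m * suc r)          ≡⟨ cong (concatMap f (x ∷ xs) ‼_) index ⟩
  concatMap f (x ∷ xs) ‼ (length (f x) + (j + m * r)) ≡⟨ ‼-++ʳ (f x) (concatMap f xs) (j + m * r) ⟩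
  concatMap f xs ‼ (j + m * r)                    ≡⟨ ‼-concatMap f m len xs r j xs‼r fx‼j ⟩
  just _                                          ∎
  where
  open ≡-Reasoning
  index : j + m * suc r ≡ length (f x) + (j + m * r)
  index rewrite len x | *-suc m r = +-left-comm j m (m * r)

applyUpTo-cong-< : {A : Set} {f g : ℕ → A} (m : ℕ) →
  (∀ {i} → i < m → f i ≡ g i) → applyUpTo f m ≡ applyUpTo g m
applyUpTo-cong-< zero    f≡g = refl
applyUpTo-cong-< (suc m) f≡g = cong₂ _∷_ (f≡g (s≤s z≤n)) (applyUpTo-cong-< m (λ i<m → f≡g (s≤s i<m)))

sum-map-*ˡ : (k : ℕ) (ns : List ℕ) → sum (map (k *_) ns) ≡ k * sum ns
sum-map-*ˡ k []       = sym (*-zeroʳ k)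
sum-map-*ˡ k (n ∷ ns) = trans (cong (k * n +_) (sum-map-*ˡ k ns)) (sym (*-distribˡ-+ k n (sum ns)))

ϖ-suc : ∀ n i → ϖ (suc n) (suc i) ≡ suc n * ϖ n i
ϖ-suc n zero    = refl
ϖ-suc n (suc i) = trans (cong ((n ∸ i) *_) (ϖ-suc n i)) (*-left-comm (n ∸ i) (suc n) (ϖ n i))

code-applyUpTo : ∀ n c → code n c ≡ sum (applyUpTo (λ i → c (n ∸ i) * ϖ n i) (n ∸ 1))
code-applyUpTo n c = cong sum (map-upTo (λ i → c (n ∸ i) * ϖ n i) (n ∸ 1))

code-suc : ∀ k c → code (suc (suc k)) c ≡ c (suc (suc k)) + suc (suc k) * code (suc k) c
code-suc k c = begin
  code N c                                            ≡⟨ code-applyUpTo N c ⟩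
  c N * 1 + sum (applyUpTo (λ i → c (suc k ∸ i) * ϖ N (suc i)) k)
    ≡⟨ cong₂ _+_ (*-identityʳ (c N)) (cong sum (applyUpTo-cong-< k (λ {i} _ → term i))) ⟩
  c N + sum (applyUpTo (λ i → N * lower i) k)         ≡⟨ cong (λ ns → c N + sum ns) (map-applyUpTo lower (N *_) k) ⟨
  c N + sum (map (N *_) (applyUpTo lower k))          ≡⟨ cong (c N +_) (sum-map-*ˡ N (applyUpTo lower k)) ⟩
  c N + N * sum (applyUpTo lower k)                   ≡⟨ cong (λ s → c N + N * s) (code-applyUpTo (suc k) c) ⟨
  c N + N * code (suc k) c                            ∎
  where
  open ≡-Reasoning
  N = suc (suc k)
  lower : ℕ → ℕ
  lower i = c (suc k ∸ i) * ϖ (suc k) i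
  term : ∀ i → c (suc k ∸ i) * ϖ N (suc i) ≡ N * lower i
  term i = trans (cong (c (suc k ∸ i) *_) (ϖ-suc (suc k) i)) (*-left-comm (c (suc k ∸ i)) N (ϖ (suc k) i))

Valid : ℕ → (ℕ → ℕ) → Set
Valid n c = (m : ℕ) → 2 ≤ m → m ≤ n → c m < m

Valid-pred : ∀ {n} c → Valid (suc n) c → Valid n c
Valid-pred c valid m 2≤m m≤n = valid m 2≤m (m≤n⇒m≤1+n m≤n)

build-cong : ∀ n {c c' : ℕ → ℕ} → (∀ {m} → m ≤ n → c m ≡ c' m) → build n c ≡ build n c'
build-cong zero          c≡c' = refl
build-cong (suc zero)    c≡c' = refl
build-cong (suc (suc k)) c≡c' =
  cong₂ (S (suc (suc k))) (c≡c' ≤-refl) (build-cong (suc k) (λ m≤n → c≡c' (m≤n⇒m≤1+n m≤n)))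

ordering-‼-code : ∀ k c → Valid (suc k) c →
  code (suc k) c < suc k ! × ordering (suc k) ‼ code (suc k) c ≡ just (build (suc k) c)
ordering-‼-code zero    c valid = s≤s z≤n , refl
ordering-‼-code (suc k) c valid rewrite code-suc k c = bound , lookup
  where
  N = suc (suc k)
  r = code (suc k) c
  ih = ordering-‼-code k c (Valid-pred c valid)
  cN<N : c N < N
  cN<N = valid N (s≤s (s≤s z≤n)) ≤-refl
  bound : c N + N * r < N * suc k !
  bound = ≤-trans (+-monoˡ-< (N * r) cN<N) (subst (_≤ N * suc k !) (*-suc N r) (*-monoʳ-≤ N (proj₁ ih)))
  block : Word → List Word
  block q = map (λ j → S N j q) (upTo N)
  lookup : ordering N ‼ (c N + N * r) ≡ just (build N c)
  lookup = ‼-concatMap block N (λ q → trans (length-map _ (upTo N)) (length-upTo N))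
    (ordering (suc k)) r (c N) (proj₂ ih)
    (trans (cong (_‼ c N) (map-upTo (λ j → S N j (build (suc k) c)) N))
           (‼-applyUpTo (λ j → S N j (build (suc k) c)) cN<N))

C^-suc : ∀ j w → C^ (suc j) w ≡ C^ j (C w)
C^-suc zero    w = refl
C^-suc (suc j) w = cong C (C^-suc j w)

C^-length-++ : ∀ (vs w : Word) → C^ (length vs) (vs ++ w) ≡ w ++ vs
C^-length-++ []       w = sym (++-identityʳ w)
C^-length-++ (v ∷ vs) w = begin
  C^ (suc (length vs)) (v ∷ vs ++ w) ≡⟨ C^-suc (length vs) (v ∷ vs ++ w) ⟩
  C^ (length vs) ((vs ++ w) ++ [ v ]) ≡⟨ cong (C^ (length vs)) (++-assoc vs w [ v ]) ⟩
  C^ (length vs) (vs ++ w ++ [ v ])   ≡⟨ C^-length-++ vs (w ++ [ v ]) ⟩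
  (w ++ [ v ]) ++ vs                  ≡⟨ ++-assoc w [ v ] vs ⟩
  w ++ v ∷ vs                         ∎
  where open ≡-Reasoning

letters : ℕ → Word
letters n = map (_+ 1) (upTo n)

letters-suc : ∀ k → letters (suc k) ≡ letters k ∷ʳ suc k
letters-suc k = begin
  map (_+ 1) (upTo (suc k))       ≡⟨ cong (map (_+ 1)) (upTo-∷ʳ k) ⟨
  map (_+ 1) (upTo k ∷ʳ k)        ≡⟨ map-++ (_+ 1) (upTo k) [ k ] ⟩
  letters k ∷ʳ (k + 1)            ≡⟨ cong (letters k ∷ʳ_) (+-comm k 1) ⟩
  letters k ∷ʳ suc k              ∎
  where open ≡-Reasoning

↭-∷ʳ-inv : {A : Set} {p xs : List A} {x : A} → p ↭ xs ∷ʳ x →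
  ∃₂ λ us vs → p ≡ us ++ x ∷ vs × vs ++ us ↭ xs
↭-∷ʳ-inv {xs = xs} {x} p↭ with ∈-∃++ (∈-resp-↭ (↭-sym p↭) (∈-++⁺ʳ xs (here refl)))
... | us , vs , refl =
  us , vs , refl , ↭-trans (++-comm vs us) (subst (us ++ vs ↭_) (++-identityʳ xs) (drop-mid us xs p↭))

update : ℕ → ℕ → (ℕ → ℕ) → ℕ → ℕ
update n v f m with m ≟ n
... | yes _ = v
... | no  _ = f m

update-same : ∀ n v f → update n v f n ≡ v
update-same n v f with n ≟ n
... | yes _   = refl
... | no  n≢n = ⊥-elim (n≢n refl)

update-other : ∀ n v f {m} → ¬ m ≡ n → update n v f m ≡ f m
update-other n v f {m} m≢n with m ≟ n
... | yes m≡n = ⊥-elim (m≢n m≡n)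
... | no  _   = refl

Valid-update : ∀ {n f v} → Valid n f → v < suc n → Valid (suc n) (update (suc n) v f)
Valid-update {n} valid v<1+n m 2≤m m≤1+n with m ≟ suc n
... | yes refl = v<1+n
... | no  m≢1+n = valid m 2≤m (≤-pred (≤∧≢⇒< m≤1+n m≢1+n))

build-surjective : ∀ k (p : Word) → p ↭ letters (suc k) →
  Σ (ℕ → ℕ) λ c → Valid (suc k) c × build (suc k) c ≡ p
build-surjective zero    p p↭ = (λ _ → 0) , (λ { m (s≤s (s≤s _)) (s≤s ()) }) , sym (↭-singleton-inv p↭)
build-surjective (suc k) p p↭
  with us , vs , refl , vu↭ ← ↭-∷ʳ-inv {xs = letters (suc k)} {suc (suc k)} (subst (p ↭_) (letters-suc (suc k)) p↭)
  with c' , valid' , build≡vu ← build-surjective k (vs ++ us) vu↭ = c , Valid-update valid' |vs|<N , build≡p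
  where
  N = suc (suc k)
  c = update N (length vs) c'
  |vs|<N : length vs < N
  |vs|<N = s≤s (begin
    length vs               ≤⟨ m≤m+n (length vs) (length us) ⟩
    length vs + length us   ≡⟨ length-++ vs ⟨
    length (vs ++ us)       ≡⟨ ↭-length vu↭ ⟩
    length (letters (suc k)) ≡⟨ trans (length-map (_+ 1) (upTo (suc k))) (length-upTo (suc k)) ⟩
    suc k                   ∎)
    where open ≤-Reasoning
  below : ∀ {m} → m ≤ suc k → ¬ m ≡ N
  below m≤ refl = 1+n≰n m≤
  build≡p : build N c ≡ us ++ N ∷ vs
  build≡p = begin
    C^ (c N) (build (suc k) c ++ [ N ])
      ≡⟨ cong₂ (λ j w → C^ j (w ++ [ N ])) (update-same N (length vs) c')
               (trans (build-cong (suc k) (λ m≤ → update-other N (length vs) c' (below m≤))) build≡vu) ⟩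
    C^ (length vs) ((vs ++ us) ++ [ N ]) ≡⟨ cong (C^ (length vs)) (++-assoc vs us [ N ]) ⟩
    C^ (length vs) (vs ++ us ++ [ N ])   ≡⟨ C^-length-++ vs (us ++ [ N ]) ⟩
    (us ++ [ N ]) ++ vs                  ≡⟨ ++-assoc us [ N ] vs ⟩
    us ++ N ∷ vs                         ∎
    where open ≡-Reasoning

digits-valid : ∀ n {d : ℕ → ℕ} → ((i : ℕ) → i ≤ n ∸ 2 → d i < n ∸ i) → Valid n (λ m → d (n ∸ m))
digits-valid n {d} d<n∸i m 2≤m m≤n = subst (d (n ∸ m) <_) (m∸[m∸n]≡n m≤n) (d<n∸i (n ∸ m) (∸-monoʳ-≤ n 2≤m))

code-digits : ∀ k d → code (suc k) (λ m → d (suc k ∸ m)) ≡ digitsValue (suc k) d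
code-digits k d = begin
  code (suc k) (λ m → d (suc k ∸ m))                          ≡⟨ code-applyUpTo (suc k) (λ m → d (suc k ∸ m)) ⟩
  sum (applyUpTo (λ i → d (suc k ∸ (suc k ∸ i)) * ϖ (suc k) i) k)
    ≡⟨ cong sum (applyUpTo-cong-< k (λ {i} i<k → cong (λ j → d j * ϖ (suc k) i) (m∸[m∸n]≡n (m≤n⇒m≤1+n (<⇒≤ i<k))))) ⟩
  sum (applyUpTo (λ i → d i * ϖ (suc k) i) k)                 ≡⟨ cong sum (map-upTo (λ i → d i * ϖ (suc k) i) k) ⟨
  digitsValue (suc k) d                                       ∎
  where open ≡-Reasoning

theorem6 : (n : ℕ) → 2 ≤ n →
    ((p : Word) → p ↭ map (_+ 1) (upTo n) →
      Σ (ℕ → ℕ) (λ c → ((m : ℕ) → 2 ≤ m → m ≤ n → c m < m) × build n c ≡ p)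
      × ((c : ℕ → ℕ) → ((m : ℕ) → 2 ≤ m → m ≤ n → c m < m) → build n c ≡ p →
          code n c < n ! × ordering n ‼ code n c ≡ just p))
    × ((α : ℕ) → α < n ! → (d : ℕ → ℕ) → ((i : ℕ) → i ≤ n ∸ 2 → d i < n ∸ i) →
        α ≡ digitsValue n d →
        ordering n ‼ α ≡ just (build n (λ m → d (n ∸ m))))
theorem6 (suc k) _ = rank-is-code , unrank
  where
  rank-is-code : (p : Word) → p ↭ letters (suc k) →
    Σ (ℕ → ℕ) (λ c → Valid (suc k) c × build (suc k) c ≡ p)
    × ((c : ℕ → ℕ) → Valid (suc k) c → build (suc k) c ≡ p →
        code (suc k) c < suc k ! × ordering (suc k) ‼ code (suc k) c ≡ just p)
  rank-is-code p p↭ = build-surjective k p p↭ , λ c valid build≡p →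
    let code<n! , lookup = ordering-‼-code k c valid in code<n! , trans lookup (cong just build≡p)
  unrank : (α : ℕ) → α < suc k ! → (d : ℕ → ℕ) → ((i : ℕ) → i ≤ suc k ∸ 2 → d i < suc k ∸ i) →
    α ≡ digitsValue (suc k) d → ordering (suc k) ‼ α ≡ just (build (suc k) (λ m → d (suc k ∸ m)))
  unrank α _ d d<n∸i refl =
    subst (λ i → ordering (suc k) ‼ i ≡ just (build (suc k) (λ m → d (suc k ∸ m)))) (code-digits k d)
          (proj₂ (ordering-‼-code k (λ m → d (suc k ∸ m)) (digits-valid (suc k) d<n∸i)))
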